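{- For any integers $r,t,n$ with $3\le r=t+1<n$ there exists a connected graph $G$ of order $n$ with $pd_s(G)=r$ and $dim_s(G)=t$.
   Context: Graphs are finite, simple, connected; $d_G$ is shortest-path distance, $d_G(x,W)=\min\{d_G(x,w):w\in W\}$. A vertex $v$ strongly resolves different vertices $x,y$ if $d_G(x,v)=d_G(x,y)+d_G(y,v)$ or $d_G(y,v)=d_G(y,x)+d_G(x,v)$; the strong metric dimension $dim_s(G)$ is the minimum size of a vertex set $S$ such that every two vertices are strongly resolved by some vertex of $S$. A set $W$ strongly resolves different vertices $x,y\notin W$ if $d_G(x,W)=d_G(x,y)+d_G(y,W)$ or $d_G(y,W)=d_G(y,x)+d_G(x,W)$. A vertex partition $\Pi$ is a strong resolving partition if every two different vertices in the same set of $\Pi$ are strongly resolved by some set of $\Pi$; $pd_s(G)$ is the minimum cardinality of such a partition. -}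

module Defs where

open import Data.Nat using (ℕ; zero; suc; _+_; _≤_)
open import Data.Fin using (Fin)
import Data.Fin as Fin
open import Data.Vec using (tabulate)
open import Relation.Nullary.Decidable using (⌊_⌋)
open import Data.Fin.Subset using (Subset; _∈_; _∉_; ∣_∣)
open import Data.Product using (Σ; _×_; ∃; ∃-syntax)
open import Data.Sum using (_⊎_)
open import Relation.Binary.PropositionalEquality using (_≡_; _≢_)
open import Relation.Nullary using (¬_)

record Graph (n : ℕ) : Set₁ where
  field
    Adj     : Fin n → Fin n → Set
    irrefl  : ∀ x → ¬ Adj x x
    sym     : ∀ {x y} → Adj x y → Adj y x
open Graph public

data Walk {n : ℕ} (G : Graph n) : Fin n → Fin n → ℕ → Set where
  nil  : ∀ x → Walk G x x zero
  cons : ∀ {x y z k} → Adj G x y → Walk G y z k → Walk G x z (suc k)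

Connected : ∀ {n} → Graph n → Set
Connected G = ∀ x y → ∃[ k ] Walk G x y k

IsDist : ∀ {n} → Graph n → Fin n → Fin n → ℕ → Set
IsDist G x y k = Walk G x y k × (∀ m → Walk G x y m → k ≤ m)

IsSetDist : ∀ {n} → Graph n → Fin n → Subset n → ℕ → Set
IsSetDist G x W k =
  (∃[ w ] (w ∈ W × IsDist G x w k)) ×
  (∀ w m → w ∈ W → IsDist G x w m → k ≤ m)

StronglyResolves : ∀ {n} → Graph n → Fin n → Fin n → Fin n → Set
StronglyResolves G v x y =
  Σ ℕ λ a → Σ ℕ λ b → Σ ℕ λ c → Σ ℕ λ e →
    IsDist G x v a × IsDist G x y b × IsDist G y v c × IsDist G y x e ×
    (a ≡ b + c ⊎ c ≡ e + a)

IsStrongResolvingSet : ∀ {n} → Graph n → Subset n → Set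
IsStrongResolvingSet G S =
  ∀ x y → x ≢ y → ∃[ v ] (v ∈ S × StronglyResolves G v x y)

StrongMetricDim : ∀ {n} → Graph n → ℕ → Set
StrongMetricDim G t =
  (∃[ S ] (IsStrongResolvingSet G S × ∣ S ∣ ≡ t)) ×
  (∀ S → IsStrongResolvingSet G S → t ≤ ∣ S ∣)

SetStronglyResolves : ∀ {n} → Graph n → Subset n → Fin n → Fin n → Set
SetStronglyResolves G W x y =
  x ∉ W × y ∉ W ×
  (Σ ℕ λ a → Σ ℕ λ b → Σ ℕ λ c → Σ ℕ λ e →
    IsSetDist G x W a × IsDist G x y b × IsSetDist G y W c × IsDist G y x e ×
    (a ≡ b + c ⊎ c ≡ e + a))

-- A vertex partition into k (nonempty) classes, given by the class map
-- f : Fin n → Fin k, which is surjective; class i is { w | f w ≡ i }.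
IsPartition : ∀ {n k} → (Fin n → Fin k) → Set
IsPartition {n} {k} f = ∀ (i : Fin k) → ∃[ w ] (f w ≡ i)

Class : ∀ {n k} → (Fin n → Fin k) → Fin k → Subset n
Class f i = tabulate (λ w → ⌊ f w Fin.≟ i ⌋)

IsStrongResolvingPartition : ∀ {n k} → Graph n → (Fin n → Fin k) → Set
IsStrongResolvingPartition {k = k} G f =
  IsPartition f ×
  (∀ x y → x ≢ y → f x ≡ f y →
     ∃[ i ] SetStronglyResolves G (Class f i) x y)

StrongPartitionDim : ∀ {n} → Graph n → ℕ → Set
StrongPartitionDim {n} G r =
  (Σ (Fin n → Fin r) λ f → IsStrongResolvingPartition G f) ×
  (∀ k (f : Fin n → Fin k) → IsStrongResolvingPartition G f → r ≤ k)

module Submission where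

-- The witness is a broom: t leaves hanging from a hub, which is the end of
-- a path reaching to one more pendant vertex.  Its t + 1 pendant vertices are
-- pairwise "extremal": no third vertex lies on a shortest path through one of
-- them to the other.  Such a pair is strongly resolved only by its own two
-- vertices and by no set avoiding both, so a strong resolving set misses at
-- most one pendant vertex (dim_s ≥ t) and a strong resolving partition puts
-- all pendant vertices in different classes (pd_s ≥ t + 1).  Conversely the t
-- leaves form a strong resolving set, and the partition into the t singleton
-- leaves and the path is a strong resolving partition.

open import Data.Bool using (Bool; true; false)
open import Data.Bool.Properties using (T-≡)
open import Data.Empty using (⊥-elim)
open import Data.Fin using (Fin; toℕ; fromℕ; fromℕ<; inject≤) renaming (zero to fzero)
import Data.Fin as Fin
open import Data.Fin.Properties
  using (toℕ-injective; toℕ-fromℕ; toℕ-fromℕ<; toℕ-inject≤; toℕ<n; injective⇒≤; any?)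
open import Data.Fin.Subset using (Subset; _∈_; _∉_; _⊆_; ∣_∣; inside)
open import Data.Fin.Subset.Properties using (p⊆q⇒∣p∣≤∣q∣; ∣p∣≤∣x∷p∣; _∈?_)
open import Data.Nat using (ℕ; zero; suc; _+_; _∸_; _⊓_; _≤_; _<_; _<ᵇ_; z≤n; s≤s; ∣_-_∣)
open import Data.Nat.Properties
open import Data.Product using (Σ; _×_; _,_; proj₁; proj₂)
open import Data.Sum using (_⊎_; inj₁; inj₂; [_,_]′)
open import Data.Vec using (tabulate; _∷_; _[_]≔_)
open import Data.Vec.Properties
  using (lookup∘tabulate; lookup⇒[]=; []=⇒lookup; []≔-updates; []≔-minimal)
open import Function using (_∘_; id)
open import Function.Bundles using (Equivalence)
open import Relation.Nullary using (¬_; Dec; yes; no)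
open import Relation.Nullary.Decidable using (⌊_⌋; toWitness; fromWitness; ¬?; _×-dec_)
open import Relation.Binary.PropositionalEquality
open import Defs hiding (sym)

module _ {m : ℕ} (f : Fin m → Bool) where

  ∈-tabulate⁺ : ∀ {w} → f w ≡ true → w ∈ tabulate f
  ∈-tabulate⁺ {w} fw = lookup⇒[]= w _ (trans (lookup∘tabulate f w) fw)

  ∈-tabulate⁻ : ∀ {w} → w ∈ tabulate f → f w ≡ true
  ∈-tabulate⁻ {w} w∈ = trans (sym (lookup∘tabulate f w)) ([]=⇒lookup w∈)

∈Class⁺ : ∀ {m k} {f : Fin m → Fin k} {w i} → f w ≡ i → w ∈ Class f i
∈Class⁺ fw≡i = ∈-tabulate⁺ _ (Equivalence.to T-≡ (fromWitness fw≡i))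

∈Class⁻ : ∀ {m k} {f : Fin m → Fin k} {w i} → w ∈ Class f i → f w ≡ i
∈Class⁻ w∈ = toWitness (Equivalence.from T-≡ (∈-tabulate⁻ _ w∈))

Below : ∀ {m} → ℕ → Subset m
Below s = tabulate (λ w → toℕ w <ᵇ s)

∈Below⁺ : ∀ {m s} {w : Fin m} → toℕ w < s → w ∈ Below s
∈Below⁺ w<s = ∈-tabulate⁺ _ (Equivalence.to T-≡ (<⇒<ᵇ w<s))

∈Below⁻ : ∀ {m s} {w : Fin m} → w ∈ Below s → toℕ w < s
∈Below⁻ {w = w} w∈ = <ᵇ⇒< (toℕ w) _ (Equivalence.from T-≡ (∈-tabulate⁻ _ w∈))

∣Below∣ : ∀ m s → s ≤ m → ∣ Below {m} s ∣ ≡ s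
∣Below∣ zero    zero    _         = refl
∣Below∣ (suc m) zero    _         = ∣Below∣ m zero z≤n
∣Below∣ (suc m) (suc s) (s≤s s≤m) = cong suc (∣Below∣ m s s≤m)

∣p[x]≔inside∣≤1+∣p∣ : ∀ {m} (p : Subset m) x → ∣ p [ x ]≔ inside ∣ ≤ suc ∣ p ∣
∣p[x]≔inside∣≤1+∣p∣ (b ∷ p)     fzero    = s≤s (∣p∣≤∣x∷p∣ b p)
∣p[x]≔inside∣≤1+∣p∣ (true ∷ p)  (Fin.suc x) = s≤s (∣p[x]≔inside∣≤1+∣p∣ p x)
∣p[x]≔inside∣≤1+∣p∣ (false ∷ p) (Fin.suc x) = ∣p[x]≔inside∣≤1+∣p∣ p x

-- If every two distinct elements of P include an element of S, then S
-- misses at most one element of P, so |P| ≤ |S| + 1.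
pairwise-hit : ∀ {m} (P S : Subset m) →
               (∀ {x y} → x ∈ P → y ∈ P → x ≢ y → x ∈ S ⊎ y ∈ S) →
               ∣ P ∣ ≤ suc ∣ S ∣
pairwise-hit P S hit with any? (λ w → (w ∈? P) ×-dec ¬? (w ∈? S))
... | no none = ≤-trans (p⊆q⇒∣p∣≤∣q∣ P⊆S) (n≤1+n ∣ S ∣)
  where
  P⊆S : P ⊆ S
  P⊆S {w} w∈P with w ∈? S
  ... | yes w∈S = w∈S
  ... | no  w∉S = ⊥-elim (none (w , w∈P , w∉S))
... | yes (w , w∈P , w∉S) = ≤-trans (p⊆q⇒∣p∣≤∣q∣ P⊆S+w) (∣p[x]≔inside∣≤1+∣p∣ S w)
  where
  P⊆S+w : P ⊆ S [ w ]≔ inside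
  P⊆S+w {u} u∈P with u Fin.≟ w
  ... | yes refl = []≔-updates S w
  ... | no  u≢w  = []≔-minimal S u w u≢w
                     ([ id , (λ w∈S → ⊥-elim (w∉S w∈S)) ]′ (hit u∈P w∈P u≢w))

module _ {n : ℕ} {G : Graph n} where

  snoc : ∀ {x y z m} → Walk G x y m → Adj G y z → Walk G x z (suc m)
  snoc (nil _)    e = cons e (nil _)
  snoc (cons a w) e = cons a (snoc w e)

  reverse : ∀ {x y m} → Walk G x y m → Walk G y x m
  reverse (nil x)    = nil x
  reverse (cons a w) = snoc (reverse w) (Graph.sym G a)

-- A function d is the distance of G as soon as every d x y is realised by
-- a walk, d x x = 0, and d changes by at most one along an edge.

module Certified {n : ℕ} (G : Graph n) (d : Fin n → Fin n → ℕ)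
  (d-walk : ∀ x y → Walk G x y (d x y))
  (d-self : ∀ x → d x x ≡ 0)
  (d-step : ∀ {x z} y → Adj G x z → d x y ≤ suc (d z y))
  where

  walk-length : ∀ {x y m} → Walk G x y m → d x y ≤ m
  walk-length (nil x)            = ≤-reflexive (d-self x)
  walk-length {y = y} (cons e w) = ≤-trans (d-step y e) (s≤s (walk-length w))

  is-dist : ∀ x y → IsDist G x y (d x y)
  is-dist x y = d-walk x y , λ _ → walk-length

  dist-unique : ∀ {x y m} → IsDist G x y m → m ≡ d x y
  dist-unique {x} {y} (w , shortest) = ≤-antisym (shortest _ (d-walk x y)) (walk-length w)

  connected : Connected G
  connected x y = d x y , d-walk x y

  d-positive : ∀ {x y} → x ≢ y → 0 < d x y
  d-positive {x} {y} x≢y with d x y | d-walk x y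
  ... | zero  | nil _ = ⊥-elim (x≢y refl)
  ... | suc _ | _     = s≤s z≤n

  -- v strongly resolves x, y iff one of them lies on a shortest path
  -- from the other to v.
  Geodesic : Fin n → Fin n → Fin n → Set
  Geodesic v x y = d x v ≡ d x y + d y v ⊎ d y v ≡ d y x + d x v

  resolves : ∀ {v x y} → Geodesic v x y → StronglyResolves G v x y
  resolves {v} {x} {y} g =
    d x v , d x y , d y v , d y x , is-dist x v , is-dist x y , is-dist y v , is-dist y x , g

  resolves⁻ : ∀ {v x y} → StronglyResolves G v x y → Geodesic v x y
  resolves⁻ (_ , _ , _ , _ , dv , dxy , dyv , dyx , g)
    rewrite dist-unique dv | dist-unique dxy | dist-unique dyv | dist-unique dyx = g

  resolves-left : ∀ x y → StronglyResolves G x x y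
  resolves-left x y = resolves (inj₂ (sym (trans (cong (d y x +_) (d-self x)) (+-identityʳ _))))

  resolves-right : ∀ x y → StronglyResolves G y x y
  resolves-right x y = resolves (inj₁ (sym (trans (cong (d x y +_) (d-self y)) (+-identityʳ _))))

  singleton-dist : ∀ {W v} x → v ∈ W → (∀ {w} → w ∈ W → w ≡ v) → IsSetDist G x W (d x v)
  singleton-dist {W} {v} x v∈W only =
    (v , v∈W , is-dist x v) ,
    λ w _ w∈W dist → ≤-reflexive (sym (trans (dist-unique dist) (cong (d x) (only w∈W))))

  singleton-resolves : ∀ {W v x y} → v ∈ W → (∀ {w} → w ∈ W → w ≡ v) →
                       x ∉ W → y ∉ W → Geodesic v x y → SetStronglyResolves G W x y
  singleton-resolves {W} {v} {x} {y} v∈W only x∉W y∉W g =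
    x∉W , y∉W ,
    (d x v , d x y , d y v , d y x ,
     singleton-dist x v∈W only , is-dist x y , singleton-dist y v∈W only , is-dist y x , g)

  -- x, y is extremal if y lies on no shortest path from x to a third vertex.
  Extremal : Fin n → Fin n → Set
  Extremal x y = ∀ w → w ≢ x → w ≢ y → d x w < d x y + d y w

  farthest⇒extremal : ∀ {x y} → (∀ w → d x w ≤ d x y) → Extremal x y
  farthest⇒extremal {x} {y} far w _ w≢y =
    ≤-<-trans (far w) (m<m+n (d x y) (d-positive (w≢y ∘ sym)))

  twins⇒extremal : ∀ {x y} → x ≢ y → (∀ w → w ≢ x → w ≢ y → d x w ≡ d y w) → Extremal x y
  twins⇒extremal {x} {y} x≢y twin w w≢x w≢y =
    subst (_< d x y + d y w) (sym (twin w w≢x w≢y)) (m<n+m (d y w) (d-positive x≢y))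

  module _ {x y} (ext-xy : Extremal x y) (ext-yx : Extremal y x) where

    only-ends-resolve : ∀ {v} → v ≢ x → v ≢ y → ¬ StronglyResolves G v x y
    only-ends-resolve v≢x v≢y r with resolves⁻ r
    ... | inj₁ eq = <-irrefl eq (ext-xy _ v≢x v≢y)
    ... | inj₂ eq = <-irrefl eq (ext-yx _ v≢y v≢x)

    resolving-set-meets : ∀ {S} → IsStrongResolvingSet G S → x ≢ y → x ∈ S ⊎ y ∈ S
    resolving-set-meets srs x≢y with srs x y x≢y
    ... | v , v∈S , r with v Fin.≟ x | v Fin.≟ y
    ...   | yes refl | _        = inj₁ v∈S
    ...   | no _     | yes refl = inj₂ v∈S
    ...   | no v≢x   | no v≢y   = ⊥-elim (only-ends-resolve v≢x v≢y r)

  -- If W avoids the extremal pair x, y then d(x,W) < d(x,y) + d(y,W): a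
  -- nearest point of W to y is too close to x.
  set-misses : ∀ {W x y a b c} → Extremal x y → x ∉ W → y ∉ W →
               IsSetDist G x W a → IsDist G x y b → IsSetDist G y W c → a ≢ b + c
  set-misses {W} {x} {y} ext x∉W y∉W (_ , a-min) dxy ((w , w∈W , dyw) , _) eq =
    <⇒≱ (ext w (λ w≡x → x∉W (subst (_∈ W) w≡x w∈W)) (λ w≡y → y∉W (subst (_∈ W) w≡y w∈W)))
        (subst (_≤ d x w) (trans eq (cong₂ _+_ (dist-unique dxy) (dist-unique dyw)))
               (a-min w (d x w) w∈W (is-dist x w)))

  no-set-resolves : ∀ {W x y} → Extremal x y → Extremal y x → ¬ SetStronglyResolves G W x y
  no-set-resolves ext-xy _ (x∉W , y∉W , _ , _ , _ , _ , dxW , dxy , dyW , _ , inj₁ eq) =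
    set-misses ext-xy x∉W y∉W dxW dxy dyW eq
  no-set-resolves _ ext-yx (x∉W , y∉W , _ , _ , _ , _ , dxW , _ , dyW , dyx , inj₂ eq) =
    set-misses ext-yx y∉W x∉W dyW dyx dxW eq

  dimension-bound : (P : Subset n) → (∀ {x y} → x ∈ P → y ∈ P → x ≢ y → Extremal x y) →
                    ∀ S → IsStrongResolvingSet G S → ∣ P ∣ ≤ suc ∣ S ∣
  dimension-bound P ext S srs = pairwise-hit P S λ x∈P y∈P x≢y →
    resolving-set-meets (ext x∈P y∈P x≢y) (ext y∈P x∈P (x≢y ∘ sym)) srs x≢y

  -- Lower bound for pd_s: pairwise extremal vertices lie in distinct classes.
  partition-bound : ∀ {m k} (g : Fin m → Fin n) → (∀ {i j} → g i ≡ g j → i ≡ j) →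
                    (∀ {i j} → i ≢ j → Extremal (g i) (g j)) →
                    (f : Fin n → Fin k) → IsStrongResolvingPartition G f → m ≤ k
  partition-bound g g-inj ext f (_ , resolve) = injective⇒≤ {f = f ∘ g} separated
    where
    separated : ∀ {i j} → f (g i) ≡ f (g j) → i ≡ j
    separated {i} {j} same with i Fin.≟ j
    ... | yes i≡j = i≡j
    ... | no  i≢j = ⊥-elim (no-set-resolves (ext i≢j) (ext (i≢j ∘ sym))
                              (proj₂ (resolve (g i) (g j) (i≢j ∘ g-inj) same)))

∣m-1+m∣≡1 : ∀ m → ∣ m - suc m ∣ ≡ 1
∣m-1+m∣≡1 zero    = refl
∣m-1+m∣≡1 (suc m) = ∣m-1+m∣≡1 m

∣1+m-n∣≡1+∣m-n∣ : ∀ {m n} → n ≤ m → ∣ suc m - n ∣ ≡ suc ∣ m - n ∣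
∣1+m-n∣≡1+∣m-n∣ {m} z≤n   = cong suc (sym (∣-∣-identityʳ m))
∣1+m-n∣≡1+∣m-n∣ (s≤s n≤m) = ∣1+m-n∣≡1+∣m-n∣ n≤m

⊓-collision : ∀ {a b t} → a ⊓ t ≡ b ⊓ t → a ≢ b → t ≤ a × t ≤ b
⊓-collision {a} {b} {t} eq a≢b with ≤-total a t | ≤-total b t
... | inj₁ a≤t | inj₁ b≤t = ⊥-elim (a≢b (trans (sym (m≤n⇒m⊓n≡m a≤t)) (trans eq (m≤n⇒m⊓n≡m b≤t))))
... | inj₁ a≤t | inj₂ t≤b = ≤-reflexive (trans (sym (m≥n⇒m⊓n≡n t≤b)) (trans (sym eq) (m≤n⇒m⊓n≡m a≤t))) , t≤b
... | inj₂ t≤a | inj₁ b≤t = t≤a , ≤-reflexive (trans (sym (m≥n⇒m⊓n≡n t≤a)) (trans eq (m≤n⇒m⊓n≡m b≤t)))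
... | inj₂ t≤a | inj₂ t≤b = t≤a , t≤b

⊓-capped-zero : ∀ {a t} → 0 < t → a ⊓ t ≡ 0 → a ≡ 0
⊓-capped-zero {a} {t} 0<t eq with ≤-total a t
... | inj₁ a≤t = trans (sym (m≤n⇒m⊓n≡m a≤t)) eq
... | inj₂ t≤a = ⊥-elim (<-irrefl (sym (trans (sym (m≥n⇒m⊓n≡n t≤a)) eq)) 0<t)

∣-∣-between-above : ∀ {a b c} → a ≤ c → c ≤ b → ∣ a - c ∣ ≤ ∣ a - b ∣
∣-∣-between-above {a} a≤c c≤b =
  subst₂ _≤_ (sym (m≤n⇒∣m-n∣≡n∸m a≤c)) (sym (m≤n⇒∣m-n∣≡n∸m (≤-trans a≤c c≤b)))
         (∸-monoˡ-≤ a c≤b)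

∣-∣-between-below : ∀ {a b c} → b ≤ c → c ≤ a → ∣ a - c ∣ ≤ ∣ a - b ∣
∣-∣-between-below {a} b≤c c≤a =
  subst₂ _≤_ (sym (m≤n⇒∣n-m∣≡n∸m c≤a)) (sym (m≤n⇒∣n-m∣≡n∸m (≤-trans b≤c c≤a)))
         (∸-monoʳ-≤ a b≤c)

∣-∣-additive : ∀ {a b c} → a ≤ b → b ≤ c → ∣ a - c ∣ ≡ ∣ a - b ∣ + ∣ b - c ∣
∣-∣-additive {a} {b} {c} a≤b b≤c = begin
  ∣ a - c ∣               ≡⟨ m≤n⇒∣m-n∣≡n∸m (≤-trans a≤b b≤c) ⟩
  c ∸ a                   ≡⟨ cong (_∸ a) (sym (m∸n+n≡m b≤c)) ⟩
  (c ∸ b + b) ∸ a         ≡⟨ +-∸-assoc (c ∸ b) a≤b ⟩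
  c ∸ b + (b ∸ a)         ≡⟨ +-comm (c ∸ b) (b ∸ a) ⟩
  b ∸ a + (c ∸ b)         ≡⟨ sym (cong₂ _+_ (m≤n⇒∣m-n∣≡n∸m a≤b) (m≤n⇒∣m-n∣≡n∸m b≤c)) ⟩
  ∣ a - b ∣ + ∣ b - c ∣   ∎
  where open ≡-Reasoning

-- Vertices a < t are leaves hanging from the hub E; the vertices
-- t, t + 1, …, E form a path.  Placing every path vertex a at position a and
-- all leaves at position n = E + 1, the distance is the line metric on
-- positions, except that two distinct leaves are at distance 2.

module Broom (t E : ℕ) (0<t : 0 < t) (t<E : t < E) where

  n : ℕ
  n = suc E

  t<n : t < n
  t<n = s≤s (<⇒≤ t<E)

  data Kind (a : ℕ) : Set where
    leaf : a < t → Kind a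
    path : t ≤ a → Kind a

  kind : ∀ a → Kind a
  kind a with a <? t
  ... | yes a<t = leaf a<t
  ... | no  a≮t = path (≮⇒≥ a≮t)

  pos : ℕ → ℕ
  pos a with kind a
  ... | leaf _ = n
  ... | path _ = a

  pos-leaf : ∀ {a} → a < t → pos a ≡ n
  pos-leaf {a} a<t with kind a
  ... | leaf _   = refl
  ... | path t≤a = ⊥-elim (<⇒≱ a<t t≤a)

  pos-path : ∀ {a} → t ≤ a → pos a ≡ a
  pos-path {a} t≤a with kind a
  ... | leaf a<t = ⊥-elim (<⇒≱ a<t t≤a)
  ... | path _   = refl

  LeafPair : ℕ → ℕ → Set
  LeafPair a b = a < t × b < t × a ≢ b

  leafPair? : ∀ a b → Dec (LeafPair a b)
  leafPair? a b = (a <? t) ×-dec (b <? t) ×-dec ¬? (a ≟ b)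

  D : ℕ → ℕ → ℕ
  D a b with leafPair? a b
  ... | yes _ = 2
  ... | no  _ = ∣ pos a - pos b ∣

  D-leaves : ∀ {a b} → LeafPair a b → D a b ≡ 2
  D-leaves {a} {b} pair with leafPair? a b
  ... | yes _     = refl
  ... | no  ¬pair = ⊥-elim (¬pair pair)

  D-line : ∀ {a b} → ¬ LeafPair a b → D a b ≡ ∣ pos a - pos b ∣
  D-line {a} {b} ¬pair with leafPair? a b
  ... | yes pair = ⊥-elim (¬pair pair)
  ... | no  _    = refl

  D-path : ∀ {a b} → t ≤ a ⊎ t ≤ b → D a b ≡ ∣ pos a - pos b ∣
  D-path on-path = D-line λ (a<t , b<t , _) → [ <⇒≱ a<t , <⇒≱ b<t ]′ on-path

  D-on-path : ∀ {a b} → t ≤ a → t ≤ b → D a b ≡ ∣ a - b ∣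
  D-on-path t≤a t≤b = trans (D-path (inj₁ t≤a)) (cong₂ ∣_-_∣ (pos-path t≤a) (pos-path t≤b))

  D-leaf-path : ∀ {a b} → a < t → t ≤ b → D a b ≡ ∣ n - b ∣
  D-leaf-path a<t t≤b = trans (D-path (inj₂ t≤b)) (cong₂ ∣_-_∣ (pos-leaf a<t) (pos-path t≤b))

  D-path-leaf : ∀ {a b} → t ≤ a → b < t → D a b ≡ ∣ a - n ∣
  D-path-leaf t≤a b<t = trans (D-path (inj₁ t≤a)) (cong₂ ∣_-_∣ (pos-path t≤a) (pos-leaf b<t))

  D-self : ∀ a → D a a ≡ 0
  D-self a = trans (D-line (λ (_ , _ , a≢a) → a≢a refl)) (∣n-n∣≡0 (pos a))

  D-sym : ∀ a b → D a b ≡ D b a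
  D-sym a b = by-cases (leafPair? a b)
    where
    by-cases : Dec (LeafPair a b) → D a b ≡ D b a
    by-cases (yes (a<t , b<t , a≢b)) =
      trans (D-leaves (a<t , b<t , a≢b)) (sym (D-leaves (b<t , a<t , a≢b ∘ sym)))
    by-cases (no ¬pair) = begin
      D a b              ≡⟨ D-line ¬pair ⟩
      ∣ pos a - pos b ∣  ≡⟨ ∣-∣-comm (pos a) (pos b) ⟩
      ∣ pos b - pos a ∣  ≡⟨ sym (D-line (λ (b<t , a<t , b≢a) → ¬pair (a<t , b<t , b≢a ∘ sym))) ⟩
      D b a              ∎
      where open ≡-Reasoning

  pos-≤-D : ∀ a b → ∣ pos a - pos b ∣ ≤ D a b
  pos-≤-D a b = by-cases (leafPair? a b)
    where
    by-cases : Dec (LeafPair a b) → ∣ pos a - pos b ∣ ≤ D a b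
    by-cases (yes (a<t , b<t , _)) =
      subst (_≤ D a b) (sym (trans (cong₂ ∣_-_∣ (pos-leaf a<t) (pos-leaf b<t)) (∣n-n∣≡0 n))) z≤n
    by-cases (no ¬pair) = ≤-reflexive (sym (D-line ¬pair))

  Edge : ℕ → ℕ → Set
  Edge a b = (a < t × b ≡ E) ⊎ (t ≤ a × b ≡ suc a)

  Adjacent : ℕ → ℕ → Set
  Adjacent a b = Edge a b ⊎ Edge b a

  edge-irrefl : ∀ a → ¬ Edge a a
  edge-irrefl a (inj₁ (a<t , a≡E)) = <-irrefl refl (<-trans (subst (_< t) a≡E a<t) t<E)
  edge-irrefl a (inj₂ (_ , a≡1+a)) = <-irrefl a≡1+a ≤-refl

  broom : Graph n
  broom = record
    { Adj    = λ x y → Adjacent (toℕ x) (toℕ y)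
    ; irrefl = λ x → [ edge-irrefl (toℕ x) , edge-irrefl (toℕ x) ]′
    ; sym    = [ inj₂ , inj₁ ]′
    }

  edge-pos : ∀ {a b} → Edge a b → ∣ pos a - pos b ∣ ≡ 1
  edge-pos (inj₁ (a<t , refl)) =
    trans (cong₂ ∣_-_∣ (pos-leaf a<t) (pos-path (<⇒≤ t<E))) (trans (∣-∣-comm n E) (∣m-1+m∣≡1 E))
  edge-pos {a} (inj₂ (t≤a , refl)) =
    trans (cong₂ ∣_-_∣ (pos-path t≤a) (pos-path (≤-trans t≤a (n≤1+n a)))) (∣m-1+m∣≡1 a)

  adjacent-pos : ∀ {a b} → Adjacent a b → ∣ pos a - pos b ∣ ≡ 1
  adjacent-pos (inj₁ e)        = edge-pos e
  adjacent-pos {a} {b} (inj₂ e) = trans (∣-∣-comm (pos a) (pos b)) (edge-pos e)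

  leaf-neighbour : ∀ {a b} → a < t → Adjacent a b → b ≡ E
  leaf-neighbour _   (inj₁ (inj₁ (_ , b≡E)))   = b≡E
  leaf-neighbour a<t (inj₁ (inj₂ (t≤a , _)))   = ⊥-elim (<⇒≱ a<t t≤a)
  leaf-neighbour a<t (inj₂ (inj₁ (_ , refl)))  = ⊥-elim (<-asym a<t t<E)
  leaf-neighbour a<t (inj₂ (inj₂ (t≤b , refl))) = ⊥-elim (<⇒≱ a<t (≤-trans t≤b (n≤1+n _)))

  D-step : ∀ {a c} b → Adjacent a c → D a b ≤ suc (D c b)
  D-step {a} {c} b a~c = by-cases (leafPair? a b)
    where
    hub-to-leaf : b < t → D E b ≡ 1
    hub-to-leaf b<t = trans (D-path-leaf (<⇒≤ t<E) b<t) (∣m-1+m∣≡1 E)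

    by-cases : Dec (LeafPair a b) → D a b ≤ suc (D c b)
    by-cases (yes pair@(a<t , b<t , _)) =
      subst₂ (λ u v → u ≤ suc v) (sym (D-leaves pair))
             (sym (trans (cong (λ z → D z b) (leaf-neighbour a<t a~c)) (hub-to-leaf b<t))) ≤-refl
    by-cases (no ¬pair) = begin
      D a b                                 ≡⟨ D-line ¬pair ⟩
      ∣ pos a - pos b ∣                     ≤⟨ ∣-∣-triangle (pos a) (pos c) (pos b) ⟩
      ∣ pos a - pos c ∣ + ∣ pos c - pos b ∣ ≡⟨ cong (_+ ∣ pos c - pos b ∣) (adjacent-pos a~c) ⟩
      suc ∣ pos c - pos b ∣                 ≤⟨ s≤s (pos-≤-D c b) ⟩
      suc (D c b)                           ∎
      where open ≤-Reasoning

  Dv : Fin n → Fin n → ℕ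
  Dv x y = D (toℕ x) (toℕ y)

  hub : Fin n
  hub = fromℕ E

  toℕ≤E : ∀ (x : Fin n) → toℕ x ≤ E
  toℕ≤E x = ≤-pred (toℕ<n x)

  leaf-hub : ∀ {x} → toℕ x < t → Adj broom x hub
  leaf-hub x<t = inj₁ (inj₁ (x<t , toℕ-fromℕ E))

  line-walk : ∀ k {x y : Fin n} → t ≤ toℕ x → toℕ y ≡ k + toℕ x → Walk broom x y k
  line-walk zero    {x} {y} _   y≡x = subst (λ z → Walk broom x z 0) (toℕ-injective (sym y≡x)) (nil x)
  line-walk (suc k) {x} {y} t≤x y≡ =
    snoc (line-walk k t≤x (toℕ-fromℕ< mid<n))
         (inj₁ (inj₂ (subst (t ≤_) (sym (toℕ-fromℕ< mid<n)) (≤-trans t≤x (m≤n+m (toℕ x) k)) ,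
                      trans y≡ (cong suc (sym (toℕ-fromℕ< mid<n))))))
    where
    mid<n : k + toℕ x < n
    mid<n = ≤-trans (n≤1+n _) (subst (_< n) y≡ (toℕ<n y))

  path-walk : ∀ {x y} → t ≤ toℕ x → t ≤ toℕ y → Walk broom x y (Dv x y)
  path-walk {x} {y} t≤x t≤y with ≤-total (toℕ x) (toℕ y)
  ... | inj₁ x≤y = subst (Walk broom x y) (sym (trans (D-on-path t≤x t≤y) (m≤n⇒∣m-n∣≡n∸m x≤y)))
                     (line-walk (toℕ y ∸ toℕ x) t≤x (sym (m∸n+n≡m x≤y)))
  ... | inj₂ y≤x = subst (Walk broom x y) (sym (trans (D-on-path t≤x t≤y) (m≤n⇒∣n-m∣≡n∸m y≤x)))
                     (reverse (line-walk (toℕ x ∸ toℕ y) t≤y (sym (m∸n+n≡m y≤x))))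

  leaf-walk : ∀ {x} → toℕ x < t → ∀ y → Walk broom x y (Dv x y)
  leaf-walk {x} x<t y with y Fin.≟ x | kind (toℕ y)
  ... | yes refl | _ = subst (Walk broom x x) (sym (D-self (toℕ x))) (nil x)
  ... | no y≢x | leaf y<t =
    subst (Walk broom x y) (sym (D-leaves (x<t , y<t , y≢x ∘ sym ∘ toℕ-injective)))
          (cons (leaf-hub x<t) (cons (Graph.sym broom (leaf-hub y<t)) (nil y)))
  ... | no _ | path t≤y =
    subst (Walk broom x y) (sym via-hub) (cons (leaf-hub x<t) (path-walk t≤hub t≤y))
    where
    t≤hub : t ≤ toℕ hub
    t≤hub = subst (t ≤_) (sym (toℕ-fromℕ E)) (<⇒≤ t<E)
    via-hub : Dv x y ≡ suc (Dv hub y)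
    via-hub = begin
      Dv x y                  ≡⟨ D-leaf-path x<t t≤y ⟩
      ∣ n - toℕ y ∣           ≡⟨ ∣1+m-n∣≡1+∣m-n∣ (toℕ≤E y) ⟩
      suc ∣ E - toℕ y ∣       ≡⟨ cong (λ h → suc ∣ h - toℕ y ∣) (sym (toℕ-fromℕ E)) ⟩
      suc ∣ toℕ hub - toℕ y ∣ ≡⟨ cong suc (sym (D-on-path t≤hub t≤y)) ⟩
      suc (Dv hub y)          ∎
      where open ≡-Reasoning

  walk : ∀ x y → Walk broom x y (Dv x y)
  walk x y with kind (toℕ x) | kind (toℕ y)
  ... | leaf x<t | _        = leaf-walk x<t y
  ... | path _   | leaf y<t = subst (Walk broom x y) (D-sym (toℕ y) (toℕ x)) (reverse (leaf-walk y<t x))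
  ... | path t≤x | path t≤y = path-walk t≤x t≤y

  open Certified broom Dv walk (λ x → D-self (toℕ x)) (λ y → D-step (toℕ y))

  leaf-twins : ∀ {a b w} → a < t → b < t → w ≢ a → w ≢ b → D a w ≡ D b w
  leaf-twins {w = w} a<t b<t w≢a w≢b with kind w
  ... | leaf w<t = trans (D-leaves (a<t , w<t , w≢a ∘ sym)) (sym (D-leaves (b<t , w<t , w≢b ∘ sym)))
  ... | path t≤w = trans (D-leaf-path a<t t≤w) (sym (D-leaf-path b<t t≤w))

  end-far-from-leaves : 2 ≤ ∣ n - t ∣
  end-far-from-leaves =
    subst (2 ≤_) (sym (∣1+m-n∣≡1+∣m-n∣ (<⇒≤ t<E)))
          (s≤s (subst (1 ≤_) (sym (m≤n⇒∣n-m∣≡n∸m (<⇒≤ t<E))) (m<n⇒0<n∸m t<E)))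

  end-farthest : ∀ {a w} → a < t → w ≤ E → D a w ≤ D a t
  end-farthest {a} {w} a<t w≤E with kind w | w ≟ a
  ... | leaf _   | yes refl = subst (_≤ D a t) (sym (D-self a)) z≤n
  ... | leaf w<t | no w≢a   = subst₂ _≤_ (sym (D-leaves (a<t , w<t , w≢a ∘ sym)))
                                        (sym (D-leaf-path a<t ≤-refl)) end-far-from-leaves
  ... | path t≤w | _        = subst₂ _≤_ (sym (D-leaf-path a<t t≤w)) (sym (D-leaf-path a<t ≤-refl))
                                        (∣-∣-between-below t≤w (≤-trans w≤E (n≤1+n E)))

  leaf-farthest : ∀ {b w} → b < t → w ≤ E → D t w ≤ D t b
  leaf-farthest {b} {w} b<t w≤E with kind w
  ... | leaf w<t = ≤-reflexive (trans (D-path-leaf ≤-refl w<t) (sym (D-path-leaf ≤-refl b<t)))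
  ... | path t≤w = subst₂ _≤_ (sym (D-on-path ≤-refl t≤w)) (sym (D-path-leaf ≤-refl b<t))
                            (∣-∣-between-above t≤w (≤-trans w≤E (n≤1+n E)))

  pendant-extremal : ∀ {x y} → toℕ x ≤ t → toℕ y ≤ t → x ≢ y → Extremal x y
  pendant-extremal {x} {y} x≤t y≤t x≢y with m≤n⇒m<n∨m≡n x≤t | m≤n⇒m<n∨m≡n y≤t
  ... | inj₁ x<t | inj₁ y<t = twins⇒extremal x≢y λ w w≢x w≢y →
    leaf-twins x<t y<t (w≢x ∘ toℕ-injective) (w≢y ∘ toℕ-injective)
  ... | inj₁ x<t | inj₂ y≡t = farthest⇒extremal λ w →
    subst (λ b → Dv x w ≤ D (toℕ x) b) (sym y≡t) (end-farthest x<t (toℕ≤E w))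
  ... | inj₂ x≡t | inj₁ y<t = farthest⇒extremal λ w →
    subst (λ a → D a (toℕ w) ≤ D a (toℕ y)) (sym x≡t) (leaf-farthest y<t (toℕ≤E w))
  ... | inj₂ x≡t | inj₂ y≡t = ⊥-elim (x≢y (toℕ-injective (trans x≡t (sym y≡t))))

  toward-leaf : ∀ {a x y} → a < t → t ≤ x → x ≤ y → y ≤ E → D x a ≡ D x y + D y a
  toward-leaf {a} {x} {y} a<t t≤x x≤y y≤E = begin
    D x a                 ≡⟨ D-path-leaf t≤x a<t ⟩
    ∣ x - n ∣             ≡⟨ ∣-∣-additive x≤y (≤-trans y≤E (n≤1+n E)) ⟩
    ∣ x - y ∣ + ∣ y - n ∣ ≡⟨ sym (cong₂ _+_ (D-on-path t≤x t≤y) (D-path-leaf t≤y a<t)) ⟩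
    D x y + D y a         ∎
    where
    open ≡-Reasoning
    t≤y : t ≤ y
    t≤y = ≤-trans t≤x x≤y

  leaf-resolves-path : ∀ {a x y} → toℕ a < t → t ≤ toℕ x → t ≤ toℕ y → Geodesic a x y
  leaf-resolves-path {x = x} {y} a<t t≤x t≤y with ≤-total (toℕ x) (toℕ y)
  ... | inj₁ x≤y = inj₁ (toward-leaf a<t t≤x x≤y (toℕ≤E y))
  ... | inj₂ y≤x = inj₂ (toward-leaf a<t t≤y y≤x (toℕ≤E x))

  leaves-resolve : IsStrongResolvingSet broom (Below t)
  leaves-resolve x y _ with kind (toℕ x) | kind (toℕ y)
  ... | leaf x<t | _        = x , ∈Below⁺ x<t , resolves-left x y
  ... | path _   | leaf y<t = y , ∈Below⁺ y<t , resolves-right x y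
  ... | path t≤x | path t≤y = fzero , ∈Below⁺ 0<t , resolves (leaf-resolves-path 0<t t≤x t≤y)

  -- The partition into the singletons {a} (a < t) and the path.
  classOf : Fin n → Fin (suc t)
  classOf w = fromℕ< (s≤s (m⊓n≤n (toℕ w) t))

  toℕ-classOf : ∀ w → toℕ (classOf w) ≡ toℕ w ⊓ t
  toℕ-classOf w = toℕ-fromℕ< _

  pendant : Fin (suc t) → Fin n
  pendant i = inject≤ i t<n

  pendant≤t : ∀ i → toℕ (pendant i) ≤ t
  pendant≤t i = subst (_≤ t) (sym (toℕ-inject≤ i _)) (≤-pred (toℕ<n i))

  classOf-pendant : ∀ i → classOf (pendant i) ≡ i
  classOf-pendant i = toℕ-injective (begin
    toℕ (classOf (pendant i)) ≡⟨ toℕ-classOf (pendant i) ⟩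
    toℕ (pendant i) ⊓ t       ≡⟨ m≤n⇒m⊓n≡m (pendant≤t i) ⟩
    toℕ (pendant i)           ≡⟨ toℕ-inject≤ i _ ⟩
    toℕ i                     ∎)
    where open ≡-Reasoning

  pendant-injective : ∀ {i j} → pendant i ≡ pendant j → i ≡ j
  pendant-injective {i} {j} eq =
    trans (sym (classOf-pendant i)) (trans (cong classOf eq) (classOf-pendant j))

  class-zero : ∀ {w} → w ∈ Class classOf fzero → w ≡ fzero
  class-zero {w} w∈ = toℕ-injective (⊓-capped-zero 0<t
    (trans (sym (toℕ-classOf w)) (cong toℕ (∈Class⁻ {f = classOf} w∈))))

  path-outside-zero : ∀ {x} → t ≤ toℕ x → x ∉ Class classOf fzero
  path-outside-zero t≤x x∈ = <⇒≱ 0<t (subst (λ z → t ≤ toℕ z) (class-zero x∈) t≤x)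

  -- Two vertices in the same class are on the path; the leaf 0 resolves them.
  classes-resolve : ∀ x y → x ≢ y → classOf x ≡ classOf y →
                    Σ (Fin (suc t)) λ i → SetStronglyResolves broom (Class classOf i) x y
  classes-resolve x y x≢y same = fzero ,
    singleton-resolves (∈Class⁺ {f = classOf} refl) class-zero
                       (path-outside-zero t≤x) (path-outside-zero t≤y)
                       (leaf-resolves-path 0<t t≤x t≤y)
    where
    on-path : t ≤ toℕ x × t ≤ toℕ y
    on-path = ⊓-collision (trans (sym (toℕ-classOf x)) (trans (cong toℕ same) (toℕ-classOf y)))
                          (x≢y ∘ toℕ-injective)
    t≤x : t ≤ toℕ x
    t≤x = proj₁ on-path
    t≤y : t ≤ toℕ y
    t≤y = proj₂ on-path

  partition-lower : ∀ k (f : Fin n → Fin k) → IsStrongResolvingPartition broom f → suc t ≤ k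
  partition-lower k = partition-bound pendant pendant-injective λ i≢j →
    pendant-extremal (pendant≤t _) (pendant≤t _) (i≢j ∘ pendant-injective)

  dimension-lower : ∀ S → IsStrongResolvingSet broom S → t ≤ ∣ S ∣
  dimension-lower S srs = ≤-pred (subst (_≤ suc ∣ S ∣) (∣Below∣ n (suc t) t<n)
    (dimension-bound (Below (suc t))
      (λ x∈ y∈ → pendant-extremal (≤-pred (∈Below⁻ x∈)) (≤-pred (∈Below⁻ y∈))) S srs))

  dimensions : Connected broom × StrongPartitionDim broom (suc t) × StrongMetricDim broom t
  dimensions =
    connected ,
    ((classOf , (λ i → pendant i , classOf-pendant i) , classes-resolve) , partition-lower) ,
    ((Below t , leaves-resolve , ∣Below∣ n t (<⇒≤ t<n)) , dimension-lower)

mainTheorem6 : ∀ (r t n : ℕ) → 3 ≤ r → r ≡ suc t → r < n →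
    Σ (Graph n) λ G → Connected G × StrongPartitionDim G r × StrongMetricDim G t
mainTheorem6 _ t (suc E) 3≤r refl (s≤s t<E) = broom , dimensions
  where
  open Broom t E (≤-trans (s≤s z≤n) (≤-pred 3≤r)) t<E
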